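{- Let $\mathcal{C}_0,\mathcal{C},\mathcal{D}_0,\mathcal{D}$ be categories, and let functors $F\colon \mathcal{C}_0\to\mathcal{C}$, $L\colon \mathcal{C}\to\mathcal{D}^{\mathrm{op}}$, $R\colon \mathcal{D}^{\mathrm{op}}\to\mathcal{C}$, $E\colon \mathcal{D}_0^{\mathrm{op}}\to\mathcal{C}_0$ and $G\colon\mathcal{D}_0\to\mathcal{D}$ be given such that (1) $L$ is left adjoint to $R$, (2) $E$ is an equivalence of categories, (3) $G$ is dense, and (4) there is a natural isomorphism $R\circ G^{\mathrm{op}}\cong F\circ E$. Then the codensity monad $\mathbb{T}^F$ of $F$ exists, the right Kan extension $\mathrm{Ran}_F F$ defining it is pointwise, and $\mathbb{T}^F$ is isomorphic (as a monad) to the monad $RL$ induced by the adjunction $L\dashv R$.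
   Context: A functor $G\colon\mathcal{A}\to\mathcal{B}$ is dense if every object $B\in\mathcal{B}$ is the colimit of the canonical (possibly large) diagram $G\circ\pi_B\colon (G\downarrow B)\to\mathcal{A}\to\mathcal{B}$, with colimit cocone given by the morphisms $f\colon GA\to B$ themselves; equivalently, $B\mapsto\mathcal{B}(G-,B)$ is fully faithful into presheaves on $\mathcal{A}$. The right Kan extension $\mathrm{Ran}_J F$ of $F\colon\mathcal{A}\to\mathcal{C}$ along $J\colon\mathcal{A}\to\mathcal{B}$ is a functor $\mathcal{B}\to\mathcal{C}$ with a counit $\varphi\colon(\mathrm{Ran}_JF)J\to F$ through which every natural transformation $GJ\to F$ factors uniquely as $\varphi\circ\hat\alpha J$; it is pointwise if $(\mathrm{Ran}_J F)X=\lim_{f\colon X\to JA}FA$ for all $X$. The codensity monad $\mathbb{T}^F$ of $F\colon\mathcal{A}\to\mathcal{C}$ is $\mathrm{Ran}_F F$ with unit $\mathrm{Id}\to\mathrm{Ran}_FF$ corresponding to $\mathrm{id}_F$ and multiplication corresponding to $\varphi\circ(\mathrm{Ran}_FF)\varphi\colon(\mathrm{Ran}_FF)(\mathrm{Ran}_FF)F\to F$ under the universal property. The monad $RL$ has unit the adjunction unit $\eta$ and multiplication $R\varepsilon L$. -}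

module Defs where

open import Level using (Level; _⊔_; suc)
open import Data.Product using (Σ; _×_; _,_; proj₁; proj₂)
import Relation.Binary as RB
import Relation.Binary.Reasoning.Setoid as SetoidR

record Category (o ℓ e : Level) : Set (suc (o ⊔ ℓ ⊔ e)) where
  infix  4 _≈_
  infixr 9 _∘_
  field
    Obj : Set o
    _⇒_ : Obj → Obj → Set ℓ
    _≈_ : ∀ {A B} → (A ⇒ B) → (A ⇒ B) → Set e
    id  : ∀ {A} → A ⇒ A
    _∘_ : ∀ {A B C} → B ⇒ C → A ⇒ B → A ⇒ C
    assoc     : ∀ {A B C D} {f : A ⇒ B} {g : B ⇒ C} {h : C ⇒ D} →
                (h ∘ g) ∘ f ≈ h ∘ (g ∘ f)
    sym-assoc : ∀ {A B C D} {f : A ⇒ B} {g : B ⇒ C} {h : C ⇒ D} →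
                h ∘ (g ∘ f) ≈ (h ∘ g) ∘ f
    identityˡ : ∀ {A B} {f : A ⇒ B} → id ∘ f ≈ f
    identityʳ : ∀ {A B} {f : A ⇒ B} → f ∘ id ≈ f
    equiv     : ∀ {A B} → RB.IsEquivalence (_≈_ {A} {B})
    ∘-resp-≈  : ∀ {A B C} {f h : B ⇒ C} {g i : A ⇒ B} →
                f ≈ h → g ≈ i → f ∘ g ≈ h ∘ i

  module Equiv {A B : Obj} = RB.IsEquivalence (equiv {A} {B})

  hom-setoid : Obj → Obj → RB.Setoid ℓ e
  hom-setoid A B = record { Carrier = A ⇒ B ; _≈_ = _≈_ ; isEquivalence = equiv }

op : ∀ {o ℓ e} → Category o ℓ e → Category o ℓ e
op C = record
  { Obj = Obj
  ; _⇒_ = λ A B → B ⇒ A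
  ; _≈_ = _≈_
  ; id = id
  ; _∘_ = λ f g → g ∘ f
  ; assoc = sym-assoc
  ; sym-assoc = assoc
  ; identityˡ = identityʳ
  ; identityʳ = identityˡ
  ; equiv = equiv
  ; ∘-resp-≈ = λ p q → ∘-resp-≈ q p
  }
  where open Category C

record Functor {o ℓ e o′ ℓ′ e′ : Level}
               (C : Category o ℓ e) (D : Category o′ ℓ′ e′)
               : Set (o ⊔ ℓ ⊔ e ⊔ o′ ⊔ ℓ′ ⊔ e′) where
  private
    module C = Category C
    module D = Category D
  field
    F₀ : C.Obj → D.Obj
    F₁ : ∀ {A B} → A C.⇒ B → F₀ A D.⇒ F₀ B
    identity     : ∀ {A} → F₁ (C.id {A}) D.≈ D.id
    homomorphism : ∀ {X Y Z} {f : X C.⇒ Y} {g : Y C.⇒ Z} →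
                   F₁ (g C.∘ f) D.≈ F₁ g D.∘ F₁ f
    F-resp-≈     : ∀ {A B} {f g : A C.⇒ B} → f C.≈ g → F₁ f D.≈ F₁ g

infixr 9 _∘F_
_∘F_ : ∀ {o ℓ e o′ ℓ′ e′ o″ ℓ″ e″}
         {A : Category o ℓ e} {B : Category o′ ℓ′ e′} {C : Category o″ ℓ″ e″} →
       Functor B C → Functor A B → Functor A C
_∘F_ {C = C} G F = record
  { F₀ = λ X → G.F₀ (F.F₀ X)
  ; F₁ = λ f → G.F₁ (F.F₁ f)
  ; identity = C.Equiv.trans (G.F-resp-≈ F.identity) G.identity
  ; homomorphism = C.Equiv.trans (G.F-resp-≈ F.homomorphism) G.homomorphism
  ; F-resp-≈ = λ p → G.F-resp-≈ (F.F-resp-≈ p)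
  }
  where
    module G = Functor G
    module F = Functor F
    module C = Category C

idF : ∀ {o ℓ e} {C : Category o ℓ e} → Functor C C
idF {C = C} = record
  { F₀ = λ X → X ; F₁ = λ f → f
  ; identity = Equiv.refl
  ; homomorphism = Equiv.refl
  ; F-resp-≈ = λ p → p }
  where open Category C

opF : ∀ {o ℓ e o′ ℓ′ e′} {C : Category o ℓ e} {D : Category o′ ℓ′ e′} →
      Functor C D → Functor (op C) (op D)
opF F = record
  { F₀ = F₀ ; F₁ = F₁
  ; identity = identity
  ; homomorphism = homomorphism
  ; F-resp-≈ = F-resp-≈ }
  where open Functor F

record NaturalTransformation {o ℓ e o′ ℓ′ e′ : Level}
         {C : Category o ℓ e} {D : Category o′ ℓ′ e′}
         (F G : Functor C D) : Set (o ⊔ ℓ ⊔ e ⊔ o′ ⊔ ℓ′ ⊔ e′) where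
  private
    module C = Category C
    module D = Category D
    module F = Functor F
    module G = Functor G
  field
    η       : ∀ X → F.F₀ X D.⇒ G.F₀ X
    commute : ∀ {X Y} (f : X C.⇒ Y) → η Y D.∘ F.F₁ f D.≈ G.F₁ f D.∘ η X

record NaturalIsomorphism {o ℓ e o′ ℓ′ e′ : Level}
         {C : Category o ℓ e} {D : Category o′ ℓ′ e′}
         (F G : Functor C D) : Set (o ⊔ ℓ ⊔ e ⊔ o′ ⊔ ℓ′ ⊔ e′) where
  private
    module D = Category D
  field
    F⇒G : NaturalTransformation F G
    F⇐G : NaturalTransformation G F
  module ⇒ = NaturalTransformation F⇒G
  module ⇐ = NaturalTransformation F⇐G
  field
    isoˡ : ∀ X → ⇐.η X D.∘ ⇒.η X D.≈ D.id
    isoʳ : ∀ X → ⇒.η X D.∘ ⇐.η X D.≈ D.id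

record Adjunction {o ℓ e o′ ℓ′ e′ : Level}
         {C : Category o ℓ e} {D : Category o′ ℓ′ e′}
         (L : Functor C D) (R : Functor D C) : Set (o ⊔ ℓ ⊔ e ⊔ o′ ⊔ ℓ′ ⊔ e′) where
  private
    module C = Category C
    module D = Category D
    module L = Functor L
    module R = Functor R
  field
    unit   : NaturalTransformation idF (R ∘F L)
    counit : NaturalTransformation (L ∘F R) idF
  module unit = NaturalTransformation unit
  module counit = NaturalTransformation counit
  field
    zig : ∀ {X} → counit.η (L.F₀ X) D.∘ L.F₁ (unit.η X) D.≈ D.id
    zag : ∀ {Y} → R.F₁ (counit.η Y) C.∘ unit.η (R.F₀ Y) C.≈ C.id

record IsCatEquivalence {o ℓ e o′ ℓ′ e′ : Level}
         {C : Category o ℓ e} {D : Category o′ ℓ′ e′}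
         (E : Functor C D) : Set (o ⊔ ℓ ⊔ e ⊔ o′ ⊔ ℓ′ ⊔ e′) where
  field
    inverse : Functor D C
    E∘inv≅id : NaturalIsomorphism (E ∘F inverse) idF
    inv∘E≅id : NaturalIsomorphism (inverse ∘F E) idF

-- G : A → B is dense if every B₀ is the colimit of the canonical diagram
--   (G ↓ B₀) → A → B ,  (X , f : G X → B₀) ↦ G X,
-- with colimit cocone given by the morphisms f themselves.
-- A morphism (X , f) → (X′ , f′) of (G ↓ B₀) is h : X → X′ with f′ ∘ G h ≈ f.
-- The colimit property is unfolded: every cocone factors uniquely.

module _ {o ℓ e o′ ℓ′ e′ : Level}
         {A : Category o ℓ e} {B : Category o′ ℓ′ e′} (G : Functor A B) where
  private
    module A = Category A
    module B = Category B
    module G = Functor G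

  record CanonicalCocone (B₀ V : B.Obj) : Set (o ⊔ ℓ ⊔ e ⊔ ℓ′ ⊔ e′) where
    field
      leg     : ∀ {X} → (G.F₀ X B.⇒ B₀) → (G.F₀ X B.⇒ V)
      natural : ∀ {X X′} (f : G.F₀ X B.⇒ B₀) (f′ : G.F₀ X′ B.⇒ B₀) (h : X A.⇒ X′) →
                f′ B.∘ G.F₁ h B.≈ f → leg f′ B.∘ G.F₁ h B.≈ leg f

  IsCanonicalColimit : B.Obj → Set (o ⊔ ℓ ⊔ e ⊔ o′ ⊔ ℓ′ ⊔ e′)
  IsCanonicalColimit B₀ =
    ∀ {V} (K : CanonicalCocone B₀ V) →
    Σ (B₀ B.⇒ V) λ u →
      (∀ {X} (f : G.F₀ X B.⇒ B₀) → u B.∘ f B.≈ CanonicalCocone.leg K f)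
      × (∀ (u′ : B₀ B.⇒ V) →
           (∀ {X} (f : G.F₀ X B.⇒ B₀) → u′ B.∘ f B.≈ CanonicalCocone.leg K f) →
           u′ B.≈ u)

  Dense : Set (o ⊔ ℓ ⊔ e ⊔ o′ ⊔ ℓ′ ⊔ e′)
  Dense = ∀ B₀ → IsCanonicalColimit B₀

record RightKanExtension {oa ℓa ea ob ℓb eb oc ℓc ec : Level}
         {A : Category oa ℓa ea} {B : Category ob ℓb eb} {C : Category oc ℓc ec}
         (J : Functor A B) (F : Functor A C)
         : Set (oa ⊔ ℓa ⊔ ea ⊔ ob ⊔ ℓb ⊔ eb ⊔ oc ⊔ ℓc ⊔ ec) where
  private
    module C = Category C
    module J = Functor J
  field
    Ran    : Functor B C
    counit : NaturalTransformation (Ran ∘F J) F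
  private
    module φ = NaturalTransformation counit
  field
    factor   : (H : Functor B C) → NaturalTransformation (H ∘F J) F →
               NaturalTransformation H Ran
    commutes : (H : Functor B C) (α : NaturalTransformation (H ∘F J) F) →
               ∀ X → φ.η X C.∘ NaturalTransformation.η (factor H α) (J.F₀ X)
                       C.≈ NaturalTransformation.η α X
    unique   : (H : Functor B C) (α : NaturalTransformation (H ∘F J) F)
               (β : NaturalTransformation H Ran) →
               (∀ X → φ.η X C.∘ NaturalTransformation.η β (J.F₀ X)
                        C.≈ NaturalTransformation.η α X) →
               ∀ Y → NaturalTransformation.η β Y
                       C.≈ NaturalTransformation.η (factor H α) Y

module _ {oa ℓa ea ob ℓb eb oc ℓc ec : Level}
         {A : Category oa ℓa ea} {B : Category ob ℓb eb} {C : Category oc ℓc ec}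
         {J : Functor A B} {F : Functor A C} (K : RightKanExtension J F) where
  private
    module A = Category A
    module B = Category B
    module C = Category C
    module J = Functor J
    module F = Functor F
    open RightKanExtension K
    module Ran = Functor Ran
    module φ = NaturalTransformation counit

  -- Diagram  (Y ↓ J) → A → C ,  (X , f : Y → J X) ↦ F X ;
  -- a morphism (X , f) → (X′ , f′) is h : X → X′ with J h ∘ f ≈ f′.
  record ConeOver (Y : B.Obj) (V : C.Obj) : Set (oa ⊔ ℓa ⊔ ℓb ⊔ eb ⊔ ℓc ⊔ ec) where
    field
      leg     : ∀ {X} → (Y B.⇒ J.F₀ X) → (V C.⇒ F.F₀ X)
      natural : ∀ {X X′} (f : Y B.⇒ J.F₀ X) (f′ : Y B.⇒ J.F₀ X′) (h : X A.⇒ X′) →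
                J.F₁ h B.∘ f B.≈ f′ → F.F₁ h C.∘ leg f C.≈ leg f′

  canonicalLeg : ∀ {Y X} → (Y B.⇒ J.F₀ X) → (Ran.F₀ Y C.⇒ F.F₀ X)
  canonicalLeg {X = X} f = φ.η X C.∘ Ran.F₁ f

  IsPointwiseAt : B.Obj → Set (oa ⊔ ℓa ⊔ ℓb ⊔ eb ⊔ oc ⊔ ℓc ⊔ ec)
  IsPointwiseAt Y =
    ∀ {V} (Co : ConeOver Y V) →
    Σ (V C.⇒ Ran.F₀ Y) λ u →
      (∀ {X} (f : Y B.⇒ J.F₀ X) → canonicalLeg f C.∘ u C.≈ ConeOver.leg Co f)
      × (∀ (u′ : V C.⇒ Ran.F₀ Y) →
           (∀ {X} (f : Y B.⇒ J.F₀ X) → canonicalLeg f C.∘ u′ C.≈ ConeOver.leg Co f) →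
           u′ C.≈ u)

  IsPointwise : Set (oa ⊔ ℓa ⊔ ob ⊔ ℓb ⊔ eb ⊔ oc ⊔ ℓc ⊔ ec)
  IsPointwise = ∀ Y → IsPointwiseAt Y

-- The monad laws are not recorded: both monads below are known to be
-- monads, and an isomorphism of monads is just a natural isomorphism
-- compatible with units and multiplications.

record MonadData {o ℓ e : Level} (C : Category o ℓ e) : Set (o ⊔ ℓ ⊔ e) where
  field
    T    : Functor C C
    unit : NaturalTransformation idF T
    mult : NaturalTransformation (T ∘F T) T

record MonadIso {o ℓ e : Level} {C : Category o ℓ e} (M N : MonadData C)
       : Set (o ⊔ ℓ ⊔ e) where
  private
    module C = Category C
    module M = MonadData M
    module N = MonadData N
    module TN = Functor N.T
  field
    iso : NaturalIsomorphism M.T N.T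
  private
    θ = NaturalTransformation.η (NaturalIsomorphism.F⇒G iso)
  field
    unit-pres : ∀ X → θ X C.∘ NaturalTransformation.η M.unit X
                      C.≈ NaturalTransformation.η N.unit X
    mult-pres : ∀ X → θ X C.∘ NaturalTransformation.η M.mult X
                      C.≈ NaturalTransformation.η N.mult X
                            C.∘ (TN.F₁ (θ X) C.∘ θ (Functor.F₀ M.T X))

adjunctionMonad : ∀ {o ℓ e o′ ℓ′ e′} {C : Category o ℓ e} {D : Category o′ ℓ′ e′}
                    {L : Functor C D} {R : Functor D C} →
                  Adjunction L R → MonadData C
adjunctionMonad {C = C} {D} {L} {R} adj = record
  { T = R ∘F L
  ; unit = Adjunction.unit adj
  ; mult = record
      { η = λ X → R.F₁ (ε.η (L.F₀ X))
      ; commute = comm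
      }
  }
  where
    module C = Category C
    module D = Category D
    module L = Functor L
    module R = Functor R
    module ε = NaturalTransformation (Adjunction.counit adj)
    comm : ∀ {X Y} (f : X C.⇒ Y) →
           R.F₁ (ε.η (L.F₀ Y)) C.∘ R.F₁ (L.F₁ (R.F₁ (L.F₁ f)))
             C.≈ R.F₁ (L.F₁ f) C.∘ R.F₁ (ε.η (L.F₀ X))
    comm {X} {Y} f = begin
          R.F₁ (ε.η (L.F₀ Y)) C.∘ R.F₁ (L.F₁ (R.F₁ (L.F₁ f)))
            ≈⟨ C.Equiv.sym R.homomorphism ⟩
          R.F₁ (ε.η (L.F₀ Y) D.∘ L.F₁ (R.F₁ (L.F₁ f)))
            ≈⟨ R.F-resp-≈ (ε.commute (L.F₁ f)) ⟩
          R.F₁ (L.F₁ f D.∘ ε.η (L.F₀ X))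
            ≈⟨ R.homomorphism ⟩
          R.F₁ (L.F₁ f) C.∘ R.F₁ (ε.η (L.F₀ X)) ∎
      where open SetoidR (C.hom-setoid _ _)

codensityMonad : ∀ {o ℓ e o′ ℓ′ e′} {A : Category o ℓ e} {C : Category o′ ℓ′ e′}
                   {F : Functor A C} → RightKanExtension F F → MonadData C
codensityMonad {A = A} {C} {F} K = record
  { T = Ran
  ; unit = factor idF idNT
  ; mult = factor (Ran ∘F Ran) β
  }
  where
    module A = Category A
    module C = Category C
    module F = Functor F
    open RightKanExtension K
    module Ran = Functor Ran
    module φ = NaturalTransformation counit

    idNT : NaturalTransformation (idF ∘F F) F
    idNT = record
      { η = λ X → C.id
      ; commute = λ f → C.Equiv.trans C.identityˡ (C.Equiv.sym C.identityʳ) }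

    comm : ∀ {X Y} (h : X A.⇒ Y) →
           (φ.η Y C.∘ Ran.F₁ (φ.η Y)) C.∘ Ran.F₁ (Ran.F₁ (F.F₁ h))
             C.≈ F.F₁ h C.∘ (φ.η X C.∘ Ran.F₁ (φ.η X))
    comm {X} {Y} h = begin
          (φ.η Y C.∘ Ran.F₁ (φ.η Y)) C.∘ Ran.F₁ (Ran.F₁ (F.F₁ h))
            ≈⟨ C.assoc ⟩
          φ.η Y C.∘ (Ran.F₁ (φ.η Y) C.∘ Ran.F₁ (Ran.F₁ (F.F₁ h)))
            ≈⟨ C.∘-resp-≈ C.Equiv.refl (C.Equiv.sym Ran.homomorphism) ⟩
          φ.η Y C.∘ Ran.F₁ (φ.η Y C.∘ Ran.F₁ (F.F₁ h))
            ≈⟨ C.∘-resp-≈ C.Equiv.refl (Ran.F-resp-≈ (φ.commute h)) ⟩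
          φ.η Y C.∘ Ran.F₁ (F.F₁ h C.∘ φ.η X)
            ≈⟨ C.∘-resp-≈ C.Equiv.refl Ran.homomorphism ⟩
          φ.η Y C.∘ (Ran.F₁ (F.F₁ h) C.∘ Ran.F₁ (φ.η X))
            ≈⟨ C.sym-assoc ⟩
          (φ.η Y C.∘ Ran.F₁ (F.F₁ h)) C.∘ Ran.F₁ (φ.η X)
            ≈⟨ C.∘-resp-≈ (φ.commute h) C.Equiv.refl ⟩
          (F.F₁ h C.∘ φ.η X) C.∘ Ran.F₁ (φ.η X)
            ≈⟨ C.assoc ⟩
          F.F₁ h C.∘ (φ.η X C.∘ Ran.F₁ (φ.η X)) ∎
      where open SetoidR (C.hom-setoid _ _)

    β : NaturalTransformation ((Ran ∘F Ran) ∘F F) F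
    β = record
      { η = λ X → φ.η X C.∘ Ran.F₁ (φ.η X)
      ; commute = comm
      }

-- Put K = G^op ∘ E⁻¹ : C₀ → D^op. Then ψ : F ≅ R K, and K is codense because G is dense
-- and E⁻¹ is an equivalence. Through F ≅ R K and L ⊣ R, arrows Y → F X correspond to
-- arrows L Y → K X of D^op, so a cone with vertex V over the diagram (Y ↓ F) is the
-- same as a cone with vertex L V over the canonical K-diagram of L Y. Codensity of K
-- factors the latter through a unique L V → L Y, i.e. the former through a unique
-- V → R L Y: so R L is the pointwise Ran_F F, with counit φ = ψ⁻¹ ∘ R(transpose of ψ).
-- Finally φ ∘ ηF = id and φ ∘ RεLF = φ ∘ RLφ, so the universal property identifies
-- the unit and multiplication of the codensity monad with η and RεL.

{-# OPTIONS --safe #-}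
module Submission where

open import Level using (Level; _⊔_)
open import Data.Product using (Σ; _×_; _,_; proj₁; proj₂)
import Relation.Binary.Reasoning.Setoid as SetoidR
open import Defs

module HomReasoning {o ℓ e} (C : Category o ℓ e) where
  open Category C
  open Equiv public
  open module ≈-Reasoning {A B} = SetoidR (hom-setoid A B) public

  infixr 4 refl⟩∘⟨_
  infixl 5 _⟩∘⟨refl

  refl⟩∘⟨_ : ∀ {A B X} {f : B ⇒ X} {g i : A ⇒ B} → g ≈ i → f ∘ g ≈ f ∘ i
  refl⟩∘⟨ p = ∘-resp-≈ refl p

  _⟩∘⟨refl : ∀ {A B X} {f h : B ⇒ X} {g : A ⇒ B} → f ≈ h → f ∘ g ≈ h ∘ g
  p ⟩∘⟨refl = ∘-resp-≈ p refl

  id-comm : ∀ {A B} {f : A ⇒ B} → id ∘ f ≈ f ∘ id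
  id-comm = trans identityˡ (sym identityʳ)

  pullˡ : ∀ {A B X Y} {a : X ⇒ Y} {b : B ⇒ X} {c : B ⇒ Y} {f : A ⇒ B} →
          a ∘ b ≈ c → a ∘ (b ∘ f) ≈ c ∘ f
  pullˡ p = trans sym-assoc (p ⟩∘⟨refl)

  pullʳ : ∀ {A B X Y} {a : B ⇒ X} {b : A ⇒ B} {c : A ⇒ X} {f : X ⇒ Y} →
          a ∘ b ≈ c → (f ∘ a) ∘ b ≈ f ∘ c
  pullʳ p = trans assoc (refl⟩∘⟨ p)

  cancelˡ : ∀ {A B X} {f : X ⇒ A} {g : A ⇒ B} {h : B ⇒ A} → h ∘ g ≈ id → h ∘ (g ∘ f) ≈ f
  cancelˡ p = trans (pullˡ p) identityˡ

  cancelʳ : ∀ {A B X} {f : B ⇒ X} {g : A ⇒ B} {h : B ⇒ A} → g ∘ h ≈ id → (f ∘ g) ∘ h ≈ f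
  cancelʳ p = trans (pullʳ p) identityʳ

  insertˡ : ∀ {A B X} {f : X ⇒ A} {g : A ⇒ B} {h : B ⇒ A} → h ∘ g ≈ id → f ≈ h ∘ (g ∘ f)
  insertˡ p = sym (cancelˡ p)

  insertʳ : ∀ {A B X} {f : B ⇒ X} {g : A ⇒ B} {h : B ⇒ A} → g ∘ h ≈ id → f ≈ (f ∘ g) ∘ h
  insertʳ p = sym (cancelʳ p)

module _ {o ℓ e o′ ℓ′ e′} {C : Category o ℓ e} {D : Category o′ ℓ′ e′} where
  private
    module C = Category C
    module D = Category D

  [_]-resp-∘ : (F : Functor C D) → let open Functor F in
               ∀ {A B X} {f : A C.⇒ B} {g : B C.⇒ X} {h : A C.⇒ X} →
               g C.∘ f C.≈ h → F₁ g D.∘ F₁ f D.≈ F₁ h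
  [ F ]-resp-∘ p = D.Equiv.trans (D.Equiv.sym homomorphism) (F-resp-≈ p)
    where open Functor F

  [_]-resp-inverse : (F : Functor C D) → let open Functor F in
                     ∀ {A B} {f : A C.⇒ B} {g : B C.⇒ A} →
                     g C.∘ f C.≈ C.id → F₁ g D.∘ F₁ f D.≈ D.id
  [ F ]-resp-inverse p = D.Equiv.trans ([ F ]-resp-∘ p) identity
    where open Functor F

module _ {o ℓ e o′ ℓ′ e′} {C : Category o ℓ e} {D : Category o′ ℓ′ e′} where
  private
    module D = Category D
  open HomReasoning D

  ≅-refl : {F : Functor C D} → NaturalIsomorphism F F
  ≅-refl = record
    { F⇒G = record { η = λ _ → D.id ; commute = λ _ → id-comm }
    ; F⇐G = record { η = λ _ → D.id ; commute = λ _ → id-comm }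
    ; isoˡ = λ _ → D.identityˡ
    ; isoʳ = λ _ → D.identityˡ
    }

  ≅-sym : {F G : Functor C D} → NaturalIsomorphism F G → NaturalIsomorphism G F
  ≅-sym α = record { F⇒G = F⇐G ; F⇐G = F⇒G ; isoˡ = isoʳ ; isoʳ = isoˡ }
    where open NaturalIsomorphism α

  unitorʳ : {F : Functor C D} → NaturalIsomorphism (F ∘F idF) F
  unitorʳ = record
    { F⇒G = record { η = λ _ → D.id ; commute = λ _ → id-comm }
    ; F⇐G = record { η = λ _ → D.id ; commute = λ _ → id-comm }
    ; isoˡ = λ _ → D.identityˡ
    ; isoʳ = λ _ → D.identityˡ
    }

  opNI : {F G : Functor C D} → NaturalIsomorphism F G → NaturalIsomorphism (opF F) (opF G)
  opNI α = record
    { F⇒G = record { η = α.⇐.η ; commute = λ f → sym (α.⇐.commute f) }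
    ; F⇐G = record { η = α.⇒.η ; commute = λ f → sym (α.⇒.commute f) }
    ; isoˡ = α.isoˡ
    ; isoʳ = α.isoʳ
    }
    where module α = NaturalIsomorphism α

  infixr 9 _ⓘᵥ_
  _ⓘᵥ_ : {F G H : Functor C D} →
         NaturalIsomorphism G H → NaturalIsomorphism F G → NaturalIsomorphism F H
  β ⓘᵥ α = record
    { F⇒G = record
        { η = λ X → β.⇒.η X D.∘ α.⇒.η X
        ; commute = λ f → trans (pullʳ (α.⇒.commute f))
                            (trans (pullˡ (β.⇒.commute f)) D.assoc) }
    ; F⇐G = record
        { η = λ X → α.⇐.η X D.∘ β.⇐.η X
        ; commute = λ f → trans (pullʳ (β.⇐.commute f))
                            (trans (pullˡ (α.⇐.commute f)) D.assoc) }
    ; isoˡ = λ X → trans (pullʳ (cancelˡ (β.isoˡ X))) (α.isoˡ X)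
    ; isoʳ = λ X → trans (pullʳ (cancelˡ (α.isoʳ X))) (β.isoʳ X)
    }
    where
      module α = NaturalIsomorphism α
      module β = NaturalIsomorphism β

module _ {o ℓ e o′ ℓ′ e′ o″ ℓ″ e″}
         {A : Category o ℓ e} {B : Category o′ ℓ′ e′} {C : Category o″ ℓ″ e″} where
  private
    module C = Category C
  open HomReasoning C

  infixr 9 _ⓘˡ_ _ⓘʳ_

  _ⓘˡ_ : (H : Functor B C) {F G : Functor A B} →
         NaturalIsomorphism F G → NaturalIsomorphism (H ∘F F) (H ∘F G)
  H ⓘˡ α = record
    { F⇒G = record { η = λ X → H.F₁ (α.⇒.η X)
                   ; commute = λ f → trans ([ H ]-resp-∘ (α.⇒.commute f)) H.homomorphism }
    ; F⇐G = record { η = λ X → H.F₁ (α.⇐.η X)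
                   ; commute = λ f → trans ([ H ]-resp-∘ (α.⇐.commute f)) H.homomorphism }
    ; isoˡ = λ X → [ H ]-resp-inverse (α.isoˡ X)
    ; isoʳ = λ X → [ H ]-resp-inverse (α.isoʳ X)
    }
    where
      module H = Functor H
      module α = NaturalIsomorphism α

  _ⓘʳ_ : {F G : Functor B C} →
         NaturalIsomorphism F G → (H : Functor A B) → NaturalIsomorphism (F ∘F H) (G ∘F H)
  α ⓘʳ H = record
    { F⇒G = record { η = λ X → α.⇒.η (H.F₀ X) ; commute = λ f → α.⇒.commute (H.F₁ f) }
    ; F⇐G = record { η = λ X → α.⇐.η (H.F₀ X) ; commute = λ f → α.⇐.commute (H.F₁ f) }
    ; isoˡ = λ X → α.isoˡ (H.F₀ X)
    ; isoʳ = λ X → α.isoʳ (H.F₀ X)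
    }
    where
      module H = Functor H
      module α = NaturalIsomorphism α

module _ {o ℓ e o′ ℓ′ e′ o″ ℓ″ e″ o‴ ℓ‴ e‴}
         {A : Category o ℓ e} {B : Category o′ ℓ′ e′}
         {C : Category o″ ℓ″ e″} {D : Category o‴ ℓ‴ e‴} where
  private
    module D = Category D
  open HomReasoning D

  associator : {F : Functor A B} {G : Functor B C} {H : Functor C D} →
               NaturalIsomorphism ((H ∘F G) ∘F F) (H ∘F (G ∘F F))
  associator = record
    { F⇒G = record { η = λ _ → D.id ; commute = λ _ → id-comm }
    ; F⇐G = record { η = λ _ → D.id ; commute = λ _ → id-comm }
    ; isoˡ = λ _ → D.identityˡ
    ; isoʳ = λ _ → D.identityˡ
    }

module _ {o ℓ e o′ ℓ′ e′} {C : Category o ℓ e} {D : Category o′ ℓ′ e′} {E : Functor C D} where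

  inverse-isCatEquivalence : (eqv : IsCatEquivalence E) →
                             IsCatEquivalence (IsCatEquivalence.inverse eqv)
  inverse-isCatEquivalence eqv = record
    { inverse = E ; E∘inv≅id = inv∘E≅id ; inv∘E≅id = E∘inv≅id }
    where open IsCatEquivalence eqv

  opF-isCatEquivalence : IsCatEquivalence E → IsCatEquivalence (opF E)
  opF-isCatEquivalence eqv = record
    { inverse = opF inverse ; E∘inv≅id = opNI E∘inv≅id ; inv∘E≅id = opNI inv∘E≅id }
    where open IsCatEquivalence eqv

module _ {o ℓ e o′ ℓ′ e′} {A : Category o ℓ e} {B : Category o′ ℓ′ e′} {G : Functor A B} where
  private
    module A = Category A
    module B = Category B
    module G = Functor G
  open HomReasoning B

  CanonicalCocone-leg-resp : ∀ {Z V} (Co : CanonicalCocone G Z V) {X} {f f′ : G.F₀ X B.⇒ Z} →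
                             f B.≈ f′ → CanonicalCocone.leg Co f B.≈ CanonicalCocone.leg Co f′
  CanonicalCocone-leg-resp Co {f = f} {f′} f≈f′ = begin
    leg f                ≈⟨ sym B.identityʳ ⟩
    leg f B.∘ B.id       ≈⟨ refl⟩∘⟨ sym G.identity ⟩
    leg f B.∘ G.F₁ A.id  ≈⟨ natural f′ f A.id (trans (refl⟩∘⟨ G.identity) (trans B.identityʳ f≈f′)) ⟩
    leg f′               ∎
    where open CanonicalCocone Co

module _ {o ℓ e o′ ℓ′ e′} {A : Category o ℓ e} {B : Category o′ ℓ′ e′} {G : Functor A B} where
  private
    module A = Category A
    module B = Category B
    module G = Functor G
  open HomReasoning B

  dense-∘-isCatEquivalence : ∀ {o″ ℓ″ e″} {A′ : Category o″ ℓ″ e″} {H : Functor A′ A} →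
                             Dense G → IsCatEquivalence H → Dense (G ∘F H)
  dense-∘-isCatEquivalence {H = H} G-dense H-equivalence Z {W} Co = u , u-commutes , u-unique
    where
      module H = Functor H
      open IsCatEquivalence H-equivalence renaming (inverse to H⁻¹)
      module H⁻¹ = Functor H⁻¹
      module ε = NaturalIsomorphism E∘inv≅id
      module η = NaturalIsomorphism inv∘E≅id
      open CanonicalCocone Co

      μ : ∀ {d} → G.F₀ d B.⇒ Z → G.F₀ d B.⇒ W
      μ {d} g = leg (g B.∘ G.F₁ (ε.⇒.η d)) B.∘ G.F₁ (ε.⇐.η d)

      μ-natural : ∀ {d d′} (g : G.F₀ d B.⇒ Z) (g′ : G.F₀ d′ B.⇒ Z) (h : d A.⇒ d′) →
                  g′ B.∘ G.F₁ h B.≈ g → μ g′ B.∘ G.F₁ h B.≈ μ g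
      μ-natural {d} {d′} g g′ h g′h≈g = begin
        (leg (g′ B.∘ G.F₁ (ε.⇒.η d′)) B.∘ G.F₁ (ε.⇐.η d′)) B.∘ G.F₁ h
          ≈⟨ pullʳ ([ G ]-resp-∘ (ε.⇐.commute h)) ⟩
        leg (g′ B.∘ G.F₁ (ε.⇒.η d′)) B.∘ G.F₁ (H.F₁ (H⁻¹.F₁ h) A.∘ ε.⇐.η d)
          ≈⟨ refl⟩∘⟨ G.homomorphism ⟩
        leg (g′ B.∘ G.F₁ (ε.⇒.η d′)) B.∘ (G.F₁ (H.F₁ (H⁻¹.F₁ h)) B.∘ G.F₁ (ε.⇐.η d))
          ≈⟨ trans B.sym-assoc (natural _ _ (H⁻¹.F₁ h) shifted ⟩∘⟨refl) ⟩
        μ g ∎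
        where
          shifted : (g′ B.∘ G.F₁ (ε.⇒.η d′)) B.∘ G.F₁ (H.F₁ (H⁻¹.F₁ h)) B.≈ g B.∘ G.F₁ (ε.⇒.η d)
          shifted = begin
            (g′ B.∘ G.F₁ (ε.⇒.η d′)) B.∘ G.F₁ (H.F₁ (H⁻¹.F₁ h)) ≈⟨ pullʳ ([ G ]-resp-∘ (ε.⇒.commute h)) ⟩
            g′ B.∘ G.F₁ (h A.∘ ε.⇒.η d)                          ≈⟨ refl⟩∘⟨ G.homomorphism ⟩
            g′ B.∘ (G.F₁ h B.∘ G.F₁ (ε.⇒.η d))                   ≈⟨ pullˡ g′h≈g ⟩
            g B.∘ G.F₁ (ε.⇒.η d)                                 ∎

      μ-cocone : CanonicalCocone G Z W
      μ-cocone = record { leg = μ ; natural = μ-natural }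

      u : Z B.⇒ W
      u = proj₁ (G-dense Z μ-cocone)

      u-commutes-on-G : ∀ {d} (g : G.F₀ d B.⇒ Z) → u B.∘ g B.≈ μ g
      u-commutes-on-G = proj₁ (proj₂ (G-dense Z μ-cocone))

      -- The equivalence need not be adjoint, so the factorisation is checked first on the
      -- image of H⁻¹ (via ε) and then transported to all objects (via η).
      u-commutes-on-H⁻¹ : ∀ {d} (g : G.F₀ (H.F₀ (H⁻¹.F₀ d)) B.⇒ Z) → u B.∘ g B.≈ leg g
      u-commutes-on-H⁻¹ {d} g = begin
        u B.∘ g
          ≈⟨ insertʳ ([ G ]-resp-inverse (ε.isoˡ d)) ⟩
        ((u B.∘ g) B.∘ G.F₁ (ε.⇐.η d)) B.∘ G.F₁ (ε.⇒.η d)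
          ≈⟨ trans B.assoc (u-commutes-on-G _) ⟩∘⟨refl ⟩
        (leg ((g B.∘ G.F₁ (ε.⇐.η d)) B.∘ G.F₁ (ε.⇒.η d)) B.∘ G.F₁ (ε.⇐.η d)) B.∘ G.F₁ (ε.⇒.η d)
          ≈⟨ CanonicalCocone-leg-resp Co (cancelʳ ([ G ]-resp-inverse (ε.isoˡ d))) ⟩∘⟨refl ⟩∘⟨refl ⟩
        (leg g B.∘ G.F₁ (ε.⇐.η d)) B.∘ G.F₁ (ε.⇒.η d)
          ≈⟨ cancelʳ ([ G ]-resp-inverse (ε.isoˡ d)) ⟩
        leg g ∎

      u-commutes : ∀ {x} (f : G.F₀ (H.F₀ x) B.⇒ Z) → u B.∘ f B.≈ leg f
      u-commutes {x} f = begin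
        u B.∘ f
          ≈⟨ refl⟩∘⟨ insertʳ ([ G ∘F H ]-resp-inverse (η.isoʳ x)) ⟩
        u B.∘ ((f B.∘ G.F₁ (H.F₁ (η.⇒.η x))) B.∘ G.F₁ (H.F₁ (η.⇐.η x)))
          ≈⟨ trans B.sym-assoc (u-commutes-on-H⁻¹ _ ⟩∘⟨refl) ⟩
        leg (f B.∘ G.F₁ (H.F₁ (η.⇒.η x))) B.∘ G.F₁ (H.F₁ (η.⇐.η x))
          ≈⟨ sym (natural _ f (η.⇒.η x) refl) ⟩∘⟨refl ⟩
        (leg f B.∘ G.F₁ (H.F₁ (η.⇒.η x))) B.∘ G.F₁ (H.F₁ (η.⇐.η x))
          ≈⟨ cancelʳ ([ G ∘F H ]-resp-inverse (η.isoʳ x)) ⟩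
        leg f ∎

      u-unique : ∀ u′ → (∀ {x} (f : G.F₀ (H.F₀ x) B.⇒ Z) → u′ B.∘ f B.≈ leg f) → u′ B.≈ u
      u-unique u′ u′-commutes = proj₂ (proj₂ (G-dense Z μ-cocone)) u′ λ {d} g → begin
        u′ B.∘ g
          ≈⟨ refl⟩∘⟨ insertʳ ([ G ]-resp-inverse (ε.isoʳ d)) ⟩
        u′ B.∘ ((g B.∘ G.F₁ (ε.⇒.η d)) B.∘ G.F₁ (ε.⇐.η d))
          ≈⟨ trans B.sym-assoc (u′-commutes _ ⟩∘⟨refl) ⟩
        μ g ∎

module _ {oa ℓa ea ob ℓb eb oc ℓc ec : Level}
         {A : Category oa ℓa ea} {B : Category ob ℓb eb} {C : Category oc ℓc ec}
         (J : Functor A B) (F : Functor A C) where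
  private
    module A = Category A
    module B where
      open Category B public
      open HomReasoning B public using (trans; _⟩∘⟨refl)
    module C = Category C
    module J = Functor J
    module F = Functor F
  open HomReasoning C

  -- ConeOver from Defs, before a Kan extension is available to index it.
  record Cone (Y : B.Obj) (V : C.Obj) : Set (oa ⊔ ℓa ⊔ ℓb ⊔ eb ⊔ ℓc ⊔ ec) where
    field
      leg     : ∀ {X} → (Y B.⇒ J.F₀ X) → (V C.⇒ F.F₀ X)
      natural : ∀ {X X′} (f : Y B.⇒ J.F₀ X) (f′ : Y B.⇒ J.F₀ X′) (h : X A.⇒ X′) →
                J.F₁ h B.∘ f B.≈ f′ → F.F₁ h C.∘ leg f C.≈ leg f′

  Cone-leg-resp : ∀ {Y V} (Co : Cone Y V) {X} {f f′ : Y B.⇒ J.F₀ X} →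
                  f B.≈ f′ → Cone.leg Co f C.≈ Cone.leg Co f′
  Cone-leg-resp Co {f = f} {f′} f≈f′ = begin
    leg f                ≈⟨ sym C.identityˡ ⟩
    C.id C.∘ leg f       ≈⟨ sym F.identity ⟩∘⟨refl ⟩
    F.F₁ A.id C.∘ leg f  ≈⟨ natural f f′ A.id (B.trans (J.identity B.⟩∘⟨refl) (B.trans B.identityˡ f≈f′)) ⟩
    leg f′               ∎
    where open Cone Co

  restrictCone : ∀ {Y′ Y V} → Y′ B.⇒ Y → Cone Y′ V → Cone Y V
  restrictCone g Co = record
    { leg = λ f → leg (f B.∘ g)
    ; natural = λ f f′ h Jh∘f≈f′ →
        natural _ _ h (B.trans B.sym-assoc (Jh∘f≈f′ B.⟩∘⟨refl))
    }
    where open Cone Co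

  IsPointwiseCounit : (Ran : Functor B C) → NaturalTransformation (Ran ∘F J) F →
                      Set (oa ⊔ ℓa ⊔ ob ⊔ ℓb ⊔ eb ⊔ oc ⊔ ℓc ⊔ ec)
  IsPointwiseCounit Ran φ = ∀ Y {V} (Co : Cone Y V) →
    Σ (V C.⇒ Ran.F₀ Y) λ u →
      (∀ {X} (f : Y B.⇒ J.F₀ X) → (φ.η X C.∘ Ran.F₁ f) C.∘ u C.≈ Cone.leg Co f)
      × (∀ (u′ : V C.⇒ Ran.F₀ Y) →
           (∀ {X} (f : Y B.⇒ J.F₀ X) → (φ.η X C.∘ Ran.F₁ f) C.∘ u′ C.≈ Cone.leg Co f) →
           u′ C.≈ u)
    where
      module Ran = Functor Ran
      module φ = NaturalTransformation φ

  module _ (Ran : Functor B C) (φ : NaturalTransformation (Ran ∘F J) F)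
           (pointwise : IsPointwiseCounit Ran φ) where
    private
      module Ran = Functor Ran
      module φ = NaturalTransformation φ

      limit : ∀ {Y V} → Cone Y V → V C.⇒ Ran.F₀ Y
      limit {Y} Co = proj₁ (pointwise Y Co)

      limit-commutes : ∀ {Y V} (Co : Cone Y V) {X} (f : Y B.⇒ J.F₀ X) →
                       (φ.η X C.∘ Ran.F₁ f) C.∘ limit Co C.≈ Cone.leg Co f
      limit-commutes {Y} Co = proj₁ (proj₂ (pointwise Y Co))

      limit-unique : ∀ {Y V} (Co : Cone Y V) (u : V C.⇒ Ran.F₀ Y) →
                     (∀ {X} (f : Y B.⇒ J.F₀ X) → (φ.η X C.∘ Ran.F₁ f) C.∘ u C.≈ Cone.leg Co f) →
                     u C.≈ limit Co
      limit-unique {Y} Co = proj₂ (proj₂ (pointwise Y Co))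

      module Factor (H : Functor B C) (α : NaturalTransformation (H ∘F J) F) where
        module H = Functor H
        module α = NaturalTransformation α

        αCone : ∀ Y → Cone Y (H.F₀ Y)
        αCone Y = record
          { leg = λ {X} f → α.η X C.∘ H.F₁ f
          ; natural = λ {X} {X′} f f′ h Jh∘f≈f′ → begin
              F.F₁ h C.∘ (α.η X C.∘ H.F₁ f)     ≈⟨ pullˡ (sym (α.commute h)) ⟩
              (α.η X′ C.∘ H.F₁ (J.F₁ h)) C.∘ H.F₁ f ≈⟨ pullʳ ([ H ]-resp-∘ Jh∘f≈f′) ⟩
              α.η X′ C.∘ H.F₁ f′                ∎
          }

        factor : NaturalTransformation H Ran
        factor = record
          { η = λ Y → limit (αCone Y)
          ; commute = λ {Y′} {Y} g →
              trans (limit-unique (restrictCone g (αCone Y′)) _ (λ {X} f → begin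
                       (φ.η X C.∘ Ran.F₁ f) C.∘ (limit (αCone Y) C.∘ H.F₁ g)
                         ≈⟨ trans C.sym-assoc (limit-commutes (αCone Y) f ⟩∘⟨refl) ⟩
                       (α.η X C.∘ H.F₁ f) C.∘ H.F₁ g
                         ≈⟨ pullʳ ([ H ]-resp-∘ B.Equiv.refl) ⟩
                       α.η X C.∘ H.F₁ (f B.∘ g) ∎))
                    (sym (limit-unique (restrictCone g (αCone Y′)) _ (λ {X} f → begin
                       (φ.η X C.∘ Ran.F₁ f) C.∘ (Ran.F₁ g C.∘ limit (αCone Y′))
                         ≈⟨ pullʳ (pullˡ ([ Ran ]-resp-∘ B.Equiv.refl)) ⟩
                       φ.η X C.∘ (Ran.F₁ (f B.∘ g) C.∘ limit (αCone Y′))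
                         ≈⟨ trans C.sym-assoc (limit-commutes (αCone Y′) (f B.∘ g)) ⟩
                       α.η X C.∘ H.F₁ (f B.∘ g) ∎)))
          }

        factor-commutes : ∀ X → φ.η X C.∘ limit (αCone (J.F₀ X)) C.≈ α.η X
        factor-commutes X = begin
          φ.η X C.∘ limit (αCone (J.F₀ X))
            ≈⟨ sym (trans (refl⟩∘⟨ Ran.identity) C.identityʳ) ⟩∘⟨refl ⟩
          (φ.η X C.∘ Ran.F₁ B.id) C.∘ limit (αCone (J.F₀ X))
            ≈⟨ limit-commutes (αCone (J.F₀ X)) B.id ⟩
          α.η X C.∘ H.F₁ B.id
            ≈⟨ trans (refl⟩∘⟨ H.identity) C.identityʳ ⟩
          α.η X ∎

        factor-unique : (β : NaturalTransformation H Ran) →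
                        (∀ X → φ.η X C.∘ NaturalTransformation.η β (J.F₀ X) C.≈ α.η X) →
                        ∀ Y → NaturalTransformation.η β Y C.≈ limit (αCone Y)
        factor-unique β φβ≈α Y = limit-unique (αCone Y) (β.η Y) λ {X} f → begin
          (φ.η X C.∘ Ran.F₁ f) C.∘ β.η Y    ≈⟨ pullʳ (sym (β.commute f)) ⟩
          φ.η X C.∘ (β.η (J.F₀ X) C.∘ H.F₁ f) ≈⟨ pullˡ (φβ≈α X) ⟩
          α.η X C.∘ H.F₁ f                  ∎
          where module β = NaturalTransformation β

    pointwiseRan : RightKanExtension J F
    pointwiseRan = record
      { Ran = Ran
      ; counit = φ
      ; factor = Factor.factor
      ; commutes = Factor.factor-commutes
      ; unique = Factor.factor-unique
      }

    pointwiseRan-isPointwise : IsPointwise pointwiseRan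
    pointwiseRan-isPointwise Y Co =
      pointwise Y (record { leg = ConeOver.leg Co ; natural = ConeOver.natural Co })

module _ {o ℓ e o′ ℓ′ e′} {C : Category o ℓ e} {D : Category o′ ℓ′ e′}
         {L : Functor C D} {R : Functor D C} (adj : Adjunction L R) where
  private
    module C = Category C
    module D = Category D
    module L = Functor L
    module R = Functor R
    module DR = HomReasoning D
  open Adjunction adj
  open HomReasoning C

  Ladjunct : ∀ {Y d} → L.F₀ Y D.⇒ d → Y C.⇒ R.F₀ d
  Ladjunct {Y} g = R.F₁ g C.∘ unit.η Y

  Radjunct : ∀ {Y d} → Y C.⇒ R.F₀ d → L.F₀ Y D.⇒ d
  Radjunct {d = d} m = counit.η d D.∘ L.F₁ m

  LRadjunct≈id : ∀ {Y d} (m : Y C.⇒ R.F₀ d) → Ladjunct (Radjunct m) C.≈ m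
  LRadjunct≈id {Y} {d} m = begin
    R.F₁ (counit.η d D.∘ L.F₁ m) C.∘ unit.η Y          ≈⟨ R.homomorphism ⟩∘⟨refl ⟩
    (R.F₁ (counit.η d) C.∘ R.F₁ (L.F₁ m)) C.∘ unit.η Y ≈⟨ pullʳ (sym (unit.commute m)) ⟩
    R.F₁ (counit.η d) C.∘ (unit.η (R.F₀ d) C.∘ m)      ≈⟨ cancelˡ zag ⟩
    m                                                  ∎

  RLadjunct≈id : ∀ {Y d} (g : L.F₀ Y D.⇒ d) → Radjunct (Ladjunct g) D.≈ g
  RLadjunct≈id {Y} {d} g = DR.begin
    counit.η d D.∘ L.F₁ (R.F₁ g C.∘ unit.η Y)              DR.≈⟨ DR.refl⟩∘⟨ L.homomorphism ⟩
    counit.η d D.∘ (L.F₁ (R.F₁ g) D.∘ L.F₁ (unit.η Y))     DR.≈⟨ DR.pullˡ (counit.commute g) ⟩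
    (g D.∘ counit.η (L.F₀ Y)) D.∘ L.F₁ (unit.η Y)          DR.≈⟨ DR.trans D.assoc (DR.refl⟩∘⟨ zig) ⟩
    g D.∘ D.id                                             DR.≈⟨ D.identityʳ ⟩
    g                                                      DR.∎

  Ladjunct-natʳ : ∀ {Y d d′} (k : d D.⇒ d′) (g : L.F₀ Y D.⇒ d) →
                  R.F₁ k C.∘ Ladjunct g C.≈ Ladjunct (k D.∘ g)
  Ladjunct-natʳ k g = pullˡ ([ R ]-resp-∘ D.Equiv.refl)

  Radjunct-natʳ : ∀ {Y d d′} (k : d D.⇒ d′) (m : Y C.⇒ R.F₀ d) →
                  k D.∘ Radjunct m D.≈ Radjunct (R.F₁ k C.∘ m)
  Radjunct-natʳ k m = DR.begin
    k D.∘ (counit.η _ D.∘ L.F₁ m)                  DR.≈⟨ DR.pullˡ (DR.sym (counit.commute k)) ⟩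
    (counit.η _ D.∘ L.F₁ (R.F₁ k)) D.∘ L.F₁ m      DR.≈⟨ DR.pullʳ ([ L ]-resp-∘ C.Equiv.refl) ⟩
    counit.η _ D.∘ L.F₁ (R.F₁ k C.∘ m)             DR.∎

  Radjunct-natˡ : ∀ {Y Y′ d} (m : Y C.⇒ R.F₀ d) (h : Y′ C.⇒ Y) →
                  Radjunct m D.∘ L.F₁ h D.≈ Radjunct (m C.∘ h)
  Radjunct-natˡ m h = DR.pullʳ ([ L ]-resp-∘ C.Equiv.refl)

module _ {o₀ ℓ₀ e₀ o ℓ e o′ ℓ′ e′}
         {C₀ : Category o₀ ℓ₀ e₀} {C : Category o ℓ e} {D : Category o′ ℓ′ e′}
         {F : Functor C₀ C} {L : Functor C D} {R : Functor D C} (adj : Adjunction L R) where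
  private
    module C = Category C
    module F = Functor F
    module L = Functor L
    module R = Functor R
    module RL = Functor (R ∘F L)
  open Adjunction adj
  open HomReasoning C

  codensityMonad≅adjunctionMonad :
    (φ : NaturalTransformation ((R ∘F L) ∘F F) F) (pointwise : IsPointwiseCounit F F (R ∘F L) φ) →
    let module φ = NaturalTransformation φ in
    (∀ X → φ.η X C.∘ unit.η (F.F₀ X) C.≈ C.id) →
    (∀ X → φ.η X C.∘ R.F₁ (counit.η (L.F₀ (F.F₀ X))) C.≈ φ.η X C.∘ RL.F₁ (φ.η X)) →
    MonadIso (codensityMonad (pointwiseRan F F (R ∘F L) φ pointwise)) (adjunctionMonad adj)
  codensityMonad≅adjunctionMonad φ pointwise φ-unit φ-mult = record
    { iso = ≅-refl
    ; unit-pres = λ X → trans C.identityˡ (sym (unique idF _ unit φ-unit X))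
    ; mult-pres = λ X → begin
        C.id C.∘ _                                      ≈⟨ C.identityˡ ⟩
        _                                               ≈⟨ sym (unique ((R ∘F L) ∘F (R ∘F L)) _
                                                                 (MonadData.mult (adjunctionMonad adj)) φ-mult X) ⟩
        R.F₁ (counit.η (L.F₀ X))                        ≈⟨ sym (trans (refl⟩∘⟨ trans C.identityʳ RL.identity)
                                                                      C.identityʳ) ⟩
        R.F₁ (counit.η (L.F₀ X)) C.∘ (RL.F₁ C.id C.∘ C.id) ∎
    }
    where open RightKanExtension (pointwiseRan F F (R ∘F L) φ pointwise)

-- Dense (opF K) says that K is codense: every object of D is the canonical limit of K.
module CodenseFactorisation
  {o₀ ℓ₀ e₀ o ℓ e o′ ℓ′ e′}
  {C₀ : Category o₀ ℓ₀ e₀} {C : Category o ℓ e} {D : Category o′ ℓ′ e′}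
  {F : Functor C₀ C} {K : Functor C₀ D} {L : Functor C D} {R : Functor D C}
  (adj : Adjunction L R) (K-codense : Dense (opF K)) (ψ : NaturalIsomorphism F (R ∘F K)) where
  private
    module C₀ = Category C₀
    module C = Category C
    module D = Category D
    module F = Functor F
    module K = Functor K
    module L = Functor L
    module R = Functor R
    module ψ = NaturalIsomorphism ψ
    module DR = HomReasoning D
    open Adjunction adj
  open HomReasoning C

  infix 10 _♭ _♯

  _♭ : ∀ {Y X} → Y C.⇒ F.F₀ X → L.F₀ Y D.⇒ K.F₀ X
  _♭ {X = X} f = Radjunct adj (ψ.⇒.η X C.∘ f)

  _♯ : ∀ {Y X} → L.F₀ Y D.⇒ K.F₀ X → Y C.⇒ F.F₀ X
  _♯ {X = X} g = ψ.⇐.η X C.∘ Ladjunct adj g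

  ♭-resp-≈ : ∀ {Y X} {f f′ : Y C.⇒ F.F₀ X} → f C.≈ f′ → f ♭ D.≈ f′ ♭
  ♭-resp-≈ f≈f′ = DR.refl⟩∘⟨ L.F-resp-≈ (refl⟩∘⟨ f≈f′)

  ♯-resp-≈ : ∀ {Y X} {g g′ : L.F₀ Y D.⇒ K.F₀ X} → g D.≈ g′ → g ♯ C.≈ g′ ♯
  ♯-resp-≈ g≈g′ = refl⟩∘⟨ (R.F-resp-≈ g≈g′ ⟩∘⟨refl)

  ♭♯≈id : ∀ {Y X} (f : Y C.⇒ F.F₀ X) → (f ♭) ♯ C.≈ f
  ♭♯≈id {X = X} f = trans (refl⟩∘⟨ LRadjunct≈id adj _) (cancelˡ (ψ.isoˡ X))

  ♯♭≈id : ∀ {Y X} (g : L.F₀ Y D.⇒ K.F₀ X) → (g ♯) ♭ D.≈ g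
  ♯♭≈id {X = X} g = DR.trans (DR.refl⟩∘⟨ L.F-resp-≈ (cancelˡ (ψ.isoʳ X))) (RLadjunct≈id adj g)

  ♭-natural : ∀ {Y X X′} (k : X C₀.⇒ X′) (f : Y C.⇒ F.F₀ X) → K.F₁ k D.∘ f ♭ D.≈ (F.F₁ k C.∘ f) ♭
  ♭-natural k f = DR.trans (Radjunct-natʳ adj (K.F₁ k) _)
                           (DR.refl⟩∘⟨ L.F-resp-≈ (trans (pullˡ (sym (ψ.⇒.commute k))) C.assoc))

  ♯-natural : ∀ {Y X X′} (k : X C₀.⇒ X′) (g : L.F₀ Y D.⇒ K.F₀ X) → F.F₁ k C.∘ g ♯ C.≈ (K.F₁ k D.∘ g) ♯
  ♯-natural k g = trans (pullˡ (sym (ψ.⇐.commute k))) (pullʳ (Ladjunct-natʳ adj (K.F₁ k) g))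

  ψ-transpose : ∀ X → L.F₀ (F.F₀ X) D.⇒ K.F₀ X
  ψ-transpose X = Radjunct adj (ψ.⇒.η X)

  ψ-transpose-natural : ∀ {X Y} (h : X C₀.⇒ Y) →
                        ψ-transpose Y D.∘ L.F₁ (F.F₁ h) D.≈ K.F₁ h D.∘ ψ-transpose X
  ψ-transpose-natural h = DR.begin
    ψ-transpose _ D.∘ L.F₁ (F.F₁ h)            DR.≈⟨ Radjunct-natˡ adj _ (F.F₁ h) ⟩
    Radjunct adj (ψ.⇒.η _ C.∘ F.F₁ h)          DR.≈⟨ DR.refl⟩∘⟨ L.F-resp-≈ (ψ.⇒.commute h) ⟩
    Radjunct adj (R.F₁ (K.F₁ h) C.∘ ψ.⇒.η _)   DR.≈⟨ DR.sym (Radjunct-natʳ adj (K.F₁ h) _) ⟩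
    K.F₁ h D.∘ ψ-transpose _                   DR.∎

  φ : NaturalTransformation ((R ∘F L) ∘F F) F
  φ = record
    { η = λ X → ψ.⇐.η X C.∘ R.F₁ (ψ-transpose X)
    ; commute = λ {X} {Y} h → begin
        (ψ.⇐.η Y C.∘ R.F₁ (ψ-transpose Y)) C.∘ R.F₁ (L.F₁ (F.F₁ h))
          ≈⟨ pullʳ ([ R ]-resp-∘ (ψ-transpose-natural h)) ⟩
        ψ.⇐.η Y C.∘ R.F₁ (K.F₁ h D.∘ ψ-transpose X)
          ≈⟨ refl⟩∘⟨ R.homomorphism ⟩
        ψ.⇐.η Y C.∘ (R.F₁ (K.F₁ h) C.∘ R.F₁ (ψ-transpose X))
          ≈⟨ trans (pullˡ (ψ.⇐.commute h)) C.assoc ⟩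
        F.F₁ h C.∘ (ψ.⇐.η X C.∘ R.F₁ (ψ-transpose X)) ∎
    }
  module φ = NaturalTransformation φ

  φ-canonicalLeg : ∀ {Y X} (f : Y C.⇒ F.F₀ X) → φ.η X C.∘ R.F₁ (L.F₁ f) C.≈ ψ.⇐.η X C.∘ R.F₁ (f ♭)
  φ-canonicalLeg f = pullʳ ([ R ]-resp-∘ (Radjunct-natˡ adj _ f))

  φ-unit : ∀ X → φ.η X C.∘ unit.η (F.F₀ X) C.≈ C.id
  φ-unit X = trans (pullʳ (LRadjunct≈id adj _)) (ψ.isoˡ X)

  ψ-transpose-equalises : ∀ X → ψ-transpose X D.∘ counit.η (L.F₀ (F.F₀ X))
                                  D.≈ ψ-transpose X D.∘ L.F₁ (φ.η X)
  ψ-transpose-equalises X = DR.begin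
    ψ-transpose X D.∘ counit.η (L.F₀ (F.F₀ X))       DR.≈⟨ DR.sym (counit.commute _) ⟩
    Radjunct adj (R.F₁ (ψ-transpose X))                DR.≈⟨ DR.refl⟩∘⟨ L.F-resp-≈ (insertˡ (ψ.isoʳ X)) ⟩
    Radjunct adj (ψ.⇒.η X C.∘ φ.η X)                          DR.≈⟨ DR.sym (Radjunct-natˡ adj _ (φ.η X)) ⟩
    ψ-transpose X D.∘ L.F₁ (φ.η X)                   DR.∎

  φ-mult : ∀ X → φ.η X C.∘ R.F₁ (counit.η (L.F₀ (F.F₀ X))) C.≈ φ.η X C.∘ R.F₁ (L.F₁ (φ.η X))
  φ-mult X = trans (pullʳ ([ R ]-resp-∘ (ψ-transpose-equalises X)))
                   (sym (pullʳ ([ R ]-resp-∘ D.Equiv.refl)))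

  transposedCone : ∀ {Y V} → Cone F F Y V → CanonicalCocone (opF K) (L.F₀ Y) (L.F₀ V)
  transposedCone Co = record
    { leg = λ g → leg (g ♯) ♭
    ; natural = λ g g′ k Kk∘g′≈g → DR.trans (♭-natural k _)
        (♭-resp-≈ (natural _ _ k (trans (♯-natural k g′) (♯-resp-≈ Kk∘g′≈g))))
    }
    where open Cone Co

  φ-isPointwise : IsPointwiseCounit F F (R ∘F L) φ
  φ-isPointwise Y {V} Co = u , u-commutes , u-unique
    where
      open Cone Co

      w : L.F₀ V D.⇒ L.F₀ Y
      w = proj₁ (K-codense (L.F₀ Y) (transposedCone Co))

      w-commutes : ∀ {X} (g : L.F₀ Y D.⇒ K.F₀ X) → g D.∘ w D.≈ leg (g ♯) ♭
      w-commutes = proj₁ (proj₂ (K-codense (L.F₀ Y) (transposedCone Co)))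

      u : V C.⇒ R.F₀ (L.F₀ Y)
      u = Ladjunct adj w

      u-commutes : ∀ {X} (f : Y C.⇒ F.F₀ X) → (φ.η X C.∘ R.F₁ (L.F₁ f)) C.∘ u C.≈ leg f
      u-commutes f = begin
        (φ.η _ C.∘ R.F₁ (L.F₁ f)) C.∘ Ladjunct adj w  ≈⟨ φ-canonicalLeg f ⟩∘⟨refl ⟩
        (ψ.⇐.η _ C.∘ R.F₁ (f ♭)) C.∘ Ladjunct adj w   ≈⟨ pullʳ (Ladjunct-natʳ adj (f ♭) w) ⟩
        (f ♭ D.∘ w) ♯                                 ≈⟨ ♯-resp-≈ (w-commutes (f ♭)) ⟩
        leg (f ♭ ♯) ♭ ♯                               ≈⟨ ♭♯≈id _ ⟩
        leg (f ♭ ♯)                                   ≈⟨ Cone-leg-resp F F Co (♭♯≈id f) ⟩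
        leg f                                         ∎

      u-unique : ∀ u′ → (∀ {X} (f : Y C.⇒ F.F₀ X) → (φ.η X C.∘ R.F₁ (L.F₁ f)) C.∘ u′ C.≈ leg f) →
                 u′ C.≈ u
      u-unique u′ u′-commutes = begin
        u′                             ≈⟨ sym (LRadjunct≈id adj u′) ⟩
        Ladjunct adj (Radjunct adj u′) ≈⟨ R.F-resp-≈ w-unique ⟩∘⟨refl ⟩
        Ladjunct adj w                 ∎
        where
          Rg∘u′ : ∀ {X} (g : L.F₀ Y D.⇒ K.F₀ X) → R.F₁ g C.∘ u′ C.≈ ψ.⇒.η X C.∘ leg (g ♯)
          Rg∘u′ {X} g = begin
            R.F₁ g C.∘ u′                                      ≈⟨ insertˡ (ψ.isoʳ X) ⟩
            ψ.⇒.η X C.∘ (ψ.⇐.η X C.∘ (R.F₁ g C.∘ u′))         ≈⟨ refl⟩∘⟨ C.sym-assoc ⟩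
            ψ.⇒.η X C.∘ ((ψ.⇐.η X C.∘ R.F₁ g) C.∘ u′)         ≈⟨ refl⟩∘⟨ (refl⟩∘⟨ R.F-resp-≈ (DR.sym (♯♭≈id g))) ⟩∘⟨refl ⟩
            ψ.⇒.η X C.∘ ((ψ.⇐.η X C.∘ R.F₁ (g ♯ ♭)) C.∘ u′)   ≈⟨ refl⟩∘⟨ sym (φ-canonicalLeg (g ♯)) ⟩∘⟨refl ⟩
            ψ.⇒.η X C.∘ ((φ.η X C.∘ R.F₁ (L.F₁ (g ♯))) C.∘ u′) ≈⟨ refl⟩∘⟨ u′-commutes (g ♯) ⟩
            ψ.⇒.η X C.∘ leg (g ♯)                              ∎

          w-unique : Radjunct adj u′ D.≈ w
          w-unique = proj₂ (proj₂ (K-codense (L.F₀ Y) (transposedCone Co))) (Radjunct adj u′) λ g →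
            DR.trans (Radjunct-natʳ adj g u′) (DR.refl⟩∘⟨ L.F-resp-≈ (Rg∘u′ g))

theorem3p2 : ∀ {o₀ ℓ₀ e₀ o ℓ e o₀′ ℓ₀′ e₀′ o′ ℓ′ e′}
               (C₀ : Category o₀ ℓ₀ e₀) (C : Category o ℓ e)
               (D₀ : Category o₀′ ℓ₀′ e₀′) (D : Category o′ ℓ′ e′)
               (F : Functor C₀ C) (L : Functor C (op D)) (R : Functor (op D) C)
               (E : Functor (op D₀) C₀) (G : Functor D₀ D) →
               (adj : Adjunction L R) →
               IsCatEquivalence E →
               Dense G →
               NaturalIsomorphism (R ∘F opF G) (F ∘F E) →
               Σ (RightKanExtension F F) λ K →
                 IsPointwise K × MonadIso (codensityMonad K) (adjunctionMonad adj)
theorem3p2 C₀ C D₀ D F L R E G adj E-equivalence G-dense θ =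
  pointwiseRan F F (R ∘F L) φ φ-isPointwise ,
  pointwiseRan-isPointwise F F (R ∘F L) φ φ-isPointwise ,
  codensityMonad≅adjunctionMonad {F = F} adj φ φ-isPointwise φ-unit φ-mult
  where
    open IsCatEquivalence E-equivalence using (inverse; E∘inv≅id)

    -- op (op D) and D agree definitionally (η for records), so this is Dense (G ∘F opF inverse).
    K-codense : Dense (opF (opF G ∘F inverse))
    K-codense = dense-∘-isCatEquivalence G-dense
                  (opF-isCatEquivalence (inverse-isCatEquivalence E-equivalence))

    F≅RK : NaturalIsomorphism F (R ∘F (opF G ∘F inverse))
    F≅RK = associator {F = inverse} {G = opF G} {H = R} ⓘᵥ (≅-sym θ ⓘʳ inverse)
             ⓘᵥ ≅-sym (associator {F = inverse} {G = E} {H = F})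
             ⓘᵥ (F ⓘˡ ≅-sym E∘inv≅id) ⓘᵥ ≅-sym unitorʳ

    open CodenseFactorisation adj K-codense F≅RK
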